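{- Let $G$ be a connected finite graph and let $\mathcal{L}$ be a degree-list assignment for $G$. Suppose that $g$ is a partial proper $\mathcal{L}$-coloring of $G$. Then for each vertex $u\in V(G)$, $G$ has a partial proper $\mathcal{L}$-coloring $f$ with $\mathrm{dom}(f)\supseteq V(G)\setminus\{u\}$ and $f\succcurlyeq g$.
   Context: A degree-list assignment gives each vertex $x$ a set $\mathcal{L}(x)$ with $|\mathcal{L}(x)|\geq\deg_G(x)$. A partial $\mathcal{L}$-coloring is a function $f$ with $\mathrm{dom}(f)\subseteq V(G)$ and $f(x)\in\mathcal{L}(x)$; proper means adjacent vertices in the domain receive distinct colors. $f\succcurlyeq g$ means $|f^{ -1}(\alpha)|\geq|g^{ -1}(\alpha)|$ for all $\alpha\in\bigcup_x\mathcal{L}(x)$. -}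

module Defs where

open import Data.Nat using (ℕ; suc; _≤_; _≥_)
open import Data.Fin using (Fin)
open import Data.Fin.Properties using (_≟_)
open import Data.List using (List; length; filter; allFin)
open import Data.List.Membership.Propositional using (_∈_)
open import Data.List.Relation.Unary.Unique.Propositional using (Unique)
open import Data.Maybe using (Maybe; just; nothing)
open import Data.Product using (_×_; Σ; ∃; ∃-syntax; _,_)
open import Relation.Nullary using (¬_; Dec)
open import Relation.Unary using (Decidable)
open import Relation.Binary.PropositionalEquality using (_≡_)
open import Data.Nat.Properties using () renaming (_≟_ to _≟ℕ_)
import Data.Maybe.Properties

record Graph (n : ℕ) : Set₁ where
  field
    Adj   : Fin n → Fin n → Set
    adj?  : (x y : Fin n) → Dec (Adj x y)
    sym   : ∀ {x y} → Adj x y → Adj y x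
    irrefl : ∀ {x} → ¬ Adj x x
open Graph public

deg : ∀ {n} → Graph n → Fin n → ℕ
deg G x = length (filter (adj? G x) (allFin _))

data Walk {n} (G : Graph n) : Fin n → Fin n → Set where
  here : ∀ {x} → Walk G x x
  step : ∀ {x y z} → Adj G x y → Walk G y z → Walk G x z

Connected : ∀ {n} → Graph n → Set
Connected G = ∀ x y → Walk G x y

-- Colors are natural numbers; a list assignment gives each vertex a finite
-- set of colors, represented as a duplicate-free list.
ListAssignment : ℕ → Set
ListAssignment n = Fin n → List ℕ

IsDegreeListAssignment : ∀ {n} → Graph n → ListAssignment n → Set
IsDegreeListAssignment G L = ∀ x → Unique (L x) × length (L x) ≥ deg G x

PartialColoring : ℕ → Set
PartialColoring n = Fin n → Maybe ℕ

IsPartialLColoring : ∀ {n} → ListAssignment n → PartialColoring n → Set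
IsPartialLColoring L f = ∀ x c → f x ≡ just c → c ∈ L x

IsProper : ∀ {n} → Graph n → PartialColoring n → Set
IsProper G f = ∀ x y c → Adj G x y → f x ≡ just c → ¬ (f y ≡ just c)

InDom : ∀ {n} → PartialColoring n → Fin n → Set
InDom f x = ∃[ c ] f x ≡ just c

colorClassSize : ∀ {n} → PartialColoring n → ℕ → ℕ
colorClassSize {n} f α = length (filter (λ x → Data.Maybe.Properties.≡-dec _≟ℕ_ (f x) (just α)) (allFin n))

_≽[_]_ : ∀ {n} → PartialColoring n → ListAssignment n → PartialColoring n → Set
_≽[_]_ {n} f L g = ∀ α → (∃[ x ] α ∈ L x) → colorClassSize f α ≥ colorClassSize g α

module Submission where

-- Colour the vertices of G one at a time, never shrinking a
-- colour class, until every vertex except u is coloured.  To colour an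
-- uncoloured vertex x ≠ u, follow a walk x = x₀, x₁, … , u.  By pigeonhole,
-- x has fewer than deg(x) ≤ |L(x)| neighbours besides x₁, so some colour
-- c ∈ L(x) appears on no neighbour of x other than x₁.  If c is not on x₁
-- either, colour x with c.  Otherwise "shift": give x the colour c of x₁
-- and uncolour x₁; this keeps the colouring proper, moves one vertex between
-- the classes up to the transposition (x x₁), and leaves x₁ as the new
-- uncoloured vertex, so we continue along the walk.  The process ends at
-- the latest when the walk reaches u, which may stay uncoloured.

open import Defs
open import Data.Empty using (⊥-elim)
open import Data.Fin using (Fin)
open import Data.Fin.Permutation.Components using (transpose; transpose-inverse)
open import Data.Fin.Properties using (_≟_)
open import Data.List using (List; []; _∷_; length; filter; map; mapMaybe; allFin)
open import Data.List.Membership.Propositional using (_∈_; _∉_; find)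
open import Data.List.Membership.Propositional.Properties using (∈-filter⁺; ∈-filter⁻; ∈-map⁻; ∈-allFin)
open import Data.List.Properties using (length-map; length-mapMaybe; filter-notAll)
open import Data.List.Relation.Binary.Subset.Propositional using (_⊆_)
open import Data.List.Relation.Unary.All using (All; all?)
open import Data.List.Relation.Unary.All.Properties using (¬All⇒Any¬)
open import Data.List.Relation.Unary.AllPairs using (_∷_)
open import Data.List.Relation.Unary.Any using (here; there)
open import Data.List.Relation.Unary.Any.Properties using (gmap; mapMaybe⁺)
open import Data.List.Relation.Unary.Unique.Propositional using (Unique)
open import Data.Maybe using (Maybe; just; nothing)
open import Data.Maybe.Properties using (≡-dec)
open import Data.Nat using (ℕ; _≤_; _<_; z≤n)
open import Data.Nat.Properties using (≤-refl; ≤-trans; n≮n; module ≤-Reasoning) renaming (_≟_ to _≟ℕ_)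
open import Data.Product using (Σ; _×_; _,_; proj₁; proj₂; ∃-syntax)
open import Data.Sum using (_⊎_; inj₁; inj₂)
open import Data.Vec.Functional using (updateAt)
open import Data.Vec.Functional.Properties using (updateAt-updates; updateAt-minimal)
open import Function using (id; const)
open import Function.Definitions using (Injective)
open import Level using (0ℓ)
open import Relation.Binary.Definitions using (DecidableEquality)
open import Relation.Binary.PropositionalEquality using (_≡_; refl; trans; cong; subst; _≢_; module ≡-Reasoning)
open import Relation.Nullary using (Dec; yes; no)
open import Relation.Nullary.Decidable using (¬?; _×-dec_; dec-true; dec-false)
open import Relation.Unary using (Pred; Decidable)
import Data.List.Relation.Unary.All as All
import Data.List.Relation.Unary.Any as Any
import Data.List.Relation.Unary.Unique.Propositional.Properties as Unique
import Data.List.Membership.DecPropositional as DecMembership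
import Data.Maybe.Relation.Unary.Any as MaybeAny
import Relation.Binary.PropositionalEquality as ≡

open DecMembership _≟ℕ_ using (_∈?_)

unique-length-≤ : {A : Set} → DecidableEquality A → {xs ys : List A} →
                  Unique xs → xs ⊆ ys → length xs ≤ length ys
unique-length-≤ _≟ᴬ_ {[]}     _                        _     = z≤n
unique-length-≤ {A} _≟ᴬ_ {x ∷ xs} {ys} (x∉xs ∷ xs-unique) xs⊆ys = begin-strict
  length xs        ≤⟨ unique-length-≤ _≟ᴬ_ xs-unique xs⊆ys∖x ⟩
  length (ys ∖ x)  <⟨ filter-notAll (x ≢?_) ys (Any.map (λ x≡y x≢y → x≢y x≡y) (xs⊆ys (here refl))) ⟩
  length ys        ∎
  where
  open ≤-Reasoning
  _≢?_ : (a b : A) → Dec (a ≢ b)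
  a ≢? b = ¬? (a ≟ᴬ b)
  _∖_ : List A → A → List A
  zs ∖ z = filter (z ≢?_) zs
  xs⊆ys∖x : xs ⊆ ys ∖ x
  xs⊆ys∖x z∈xs = ∈-filter⁺ (x ≢?_) (xs⊆ys (there z∈xs)) (All.lookup x∉xs z∈xs)

count-≤-by-injection : ∀ {n} {P Q : Pred (Fin n) 0ℓ} (P? : Decidable P) (Q? : Decidable Q)
                       (σ : Fin n → Fin n) → Injective _≡_ _≡_ σ → (∀ z → P z → Q (σ z)) →
                       length (filter P? (allFin n)) ≤ length (filter Q? (allFin n))
count-≤-by-injection {n} P? Q? σ σ-injective P⇒Q =
  subst (_≤ _) (length-map σ (filter P? (allFin n)))
    (unique-length-≤ _≟_ (Unique.map⁺ σ-injective (Unique.filter⁺ P? (Unique.allFin⁺ n))) image⊆Q)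
  where
  image⊆Q : map σ (filter P? (allFin n)) ⊆ filter Q? (allFin n)
  image⊆Q z∈image with ∈-map⁻ σ z∈image
  ... | w , w∈P , refl = ∈-filter⁺ Q? (∈-allFin (σ w)) (P⇒Q w (proj₂ (∈-filter⁻ P? {xs = allFin n} w∈P)))

transpose-injective : ∀ {n} (i j : Fin n) → Injective _≡_ _≡_ (transpose i j)
transpose-injective i j {a} {b} σa≡σb = begin
  a                             ≡⟨ ≡.sym (transpose-inverse j i) ⟩
  transpose j i (transpose i j a) ≡⟨ cong (transpose j i) σa≡σb ⟩
  transpose j i (transpose i j b) ≡⟨ transpose-inverse j i ⟩
  b                             ∎
  where open ≡-Reasoning

transpose-maps-right : ∀ {n} (i j : Fin n) → transpose i j j ≡ i
transpose-maps-right i j with j ≟ i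
... | yes j≡i = j≡i
... | no  j≢i rewrite dec-true (j ≟ j) refl = refl

transpose-fixes : ∀ {n} {i j z : Fin n} → z ≢ i → z ≢ j → transpose i j z ≡ z
transpose-fixes {i = i} {j} {z} z≢i z≢j rewrite dec-false (z ≟ i) z≢i | dec-false (z ≟ j) z≢j = refl

_[_↦_] : ∀ {n} → PartialColoring n → Fin n → Maybe ℕ → PartialColoring n
f [ x ↦ v ] = updateAt f x (const v)

↦-here : ∀ {n} (f : PartialColoring n) x v → (f [ x ↦ v ]) x ≡ v
↦-here f x v = updateAt-updates x f

↦-elsewhere : ∀ {n} (f : PartialColoring n) {x z} v → z ≢ x → (f [ x ↦ v ]) z ≡ f z
↦-elsewhere f v z≢x = updateAt-minimal _ _ f z≢x

↦-inv : ∀ {n} (f : PartialColoring n) x v z {w} → (f [ x ↦ v ]) z ≡ w →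
        (z ≡ x × v ≡ w) ⊎ (z ≢ x × f z ≡ w)
↦-inv f x v z eq with z ≟ x
... | yes refl = inj₁ (refl , trans (≡.sym (↦-here f x v)) eq)
... | no  z≢x  = inj₂ (z≢x , trans (≡.sym (↦-elsewhere f v z≢x)) eq)

_⊑_ : ∀ {n} → PartialColoring n → PartialColoring n → Set
f ⊑ f' = ∀ z {c} → f z ≡ just c → f' z ≡ just c

uncolour-⊑ : ∀ {n} (f : PartialColoring n) y → (f [ y ↦ nothing ]) ⊑ f
uncolour-⊑ f y z eq with ↦-inv f y nothing z eq
... | inj₁ (_ , ())
... | inj₂ (_ , fz≡c) = fz≡c

colour-extends : ∀ {n} (f : PartialColoring n) {x} c → f x ≡ nothing → f ⊑ (f [ x ↦ just c ])
colour-extends f {x} c fx≡nothing z fz≡c with z ≟ x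
... | yes refl with () ← trans (≡.sym fx≡nothing) fz≡c
... | no  z≢x  = trans (↦-elsewhere f (just c) z≢x) fz≡c

_≼_ : ∀ {n} → PartialColoring n → PartialColoring n → Set
f ≼ f' = ∀ α → colorClassSize f α ≤ colorClassSize f' α

≼-refl : ∀ {n} {f : PartialColoring n} → f ≼ f
≼-refl α = ≤-refl

≼-trans : ∀ {n} {f f' f'' : PartialColoring n} → f ≼ f' → f' ≼ f'' → f ≼ f''
≼-trans f≼f' f'≼f'' α = ≤-trans (f≼f' α) (f'≼f'' α)

relabel-≼ : ∀ {n} {f f' : PartialColoring n} (σ : Fin n → Fin n) → Injective _≡_ _≡_ σ →
            (∀ z {c} → f z ≡ just c → f' (σ z) ≡ just c) → f ≼ f'
relabel-≼ σ σ-injective f⇒f' α = count-≤-by-injection _ _ σ σ-injective (λ z → f⇒f' z)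

⊑⇒≼ : ∀ {n} {f f' : PartialColoring n} → f ⊑ f' → f ≼ f'
⊑⇒≼ f⊑f' = relabel-≼ id id f⊑f'

Keeps : ∀ {n} → Fin n → PartialColoring n → PartialColoring n → Set
Keeps u f f' = ∀ z → z ≢ u → InDom f z → InDom f' z

Keeps-refl : ∀ {n} {u} {f : PartialColoring n} → Keeps u f f
Keeps-refl _ _ f-colours-z = f-colours-z

⊑⇒Keeps : ∀ {n} {u} {f f' : PartialColoring n} → f ⊑ f' → Keeps u f f'
⊑⇒Keeps f⊑f' z _ (c , fz≡c) = c , f⊑f' z fz≡c

module _ {n : ℕ} (G : Graph n) (L : ListAssignment n) where

  IsProperLColouring : PartialColoring n → Set
  IsProperLColouring f = IsPartialLColoring L f × IsProper G f

  Free : PartialColoring n → Fin n → ℕ → Set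
  Free f x c = ∀ z → Adj G x z → f z ≢ just c

  FreeBesides : PartialColoring n → Fin n → Fin n → ℕ → Set
  FreeBesides f x y c = ∀ z → Adj G x z → z ≢ y → f z ≢ just c

  free-besides⇒free : ∀ {f x y c} → FreeBesides f x y c → f y ≢ just c → Free f x c
  free-besides⇒free {y = y} free-besides fy≢c z x~z with z ≟ y
  ... | yes refl = fy≢c
  ... | no  z≢y  = free-besides z x~z z≢y

  restrict-proper : ∀ {f f'} → f ⊑ f' → IsProperLColouring f' → IsProperLColouring f
  restrict-proper f⊑f' (L-colouring , proper) =
    (λ z c fz≡c → L-colouring z c (f⊑f' z fz≡c)) ,
    (λ a b c a~b fa≡c fb≡c → proper a b c a~b (f⊑f' a fa≡c) (f⊑f' b fb≡c))

  colour-proper : ∀ {f x c} → IsProperLColouring f → c ∈ L x → Free f x c →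
                  IsProperLColouring (f [ x ↦ just c ])
  colour-proper {f} {x} {c} (L-colouring , proper) c∈Lx free = L-colouring' , proper'
    where
    L-colouring' : IsPartialLColoring L (f [ x ↦ just c ])
    L-colouring' z c' eq with ↦-inv f x (just c) z eq
    ... | inj₁ (refl , refl) = c∈Lx
    ... | inj₂ (_ , fz≡c')   = L-colouring z c' fz≡c'
    proper' : IsProper G (f [ x ↦ just c ])
    proper' a b c' a~b ea eb with ↦-inv f x (just c) a ea | ↦-inv f x (just c) b eb
    ... | inj₁ (refl , _)    | inj₁ (refl , _)    = irrefl G a~b
    ... | inj₁ (refl , refl) | inj₂ (_ , fb≡c)    = free b a~b fb≡c
    ... | inj₂ (_ , fa≡c)    | inj₁ (refl , refl) = free a (Graph.sym G a~b) fa≡c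
    ... | inj₂ (_ , fa≡c')   | inj₂ (_ , fb≡c')   = proper a b c' a~b fa≡c' fb≡c'

  shift : PartialColoring n → Fin n → Fin n → ℕ → PartialColoring n
  shift f x y c = (f [ y ↦ nothing ]) [ x ↦ just c ]

  shift-x : ∀ f x y c → shift f x y c x ≡ just c
  shift-x f x y c = ↦-here _ x (just c)

  shift-y : ∀ f {x y} c → Adj G x y → shift f x y c y ≡ nothing
  shift-y f {x} {y} c x~y = trans (↦-elsewhere _ (just c) y≢x) (↦-here f y nothing)
    where
    y≢x : y ≢ x
    y≢x refl = irrefl G x~y

  shift-elsewhere : ∀ f {x y z} c → z ≢ x → z ≢ y → shift f x y c z ≡ f z
  shift-elsewhere f c z≢x z≢y = trans (↦-elsewhere _ (just c) z≢x) (↦-elsewhere f nothing z≢y)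

  shift-proper : ∀ {f x y c} → IsProperLColouring f → c ∈ L x → FreeBesides f x y c →
                 IsProperLColouring (shift f x y c)
  shift-proper {f} {x} {y} {c} proper-f c∈Lx free-besides =
    colour-proper (restrict-proper (uncolour-⊑ f y) proper-f) c∈Lx free
    where
    free : Free (f [ y ↦ nothing ]) x c
    free z x~z eq with ↦-inv f y nothing z eq
    ... | inj₁ (_ , ())
    ... | inj₂ (z≢y , fz≡c) = free-besides z x~z z≢y fz≡c

  -- Shifting c from y to x, for x uncoloured, moves exactly one vertex of the
  -- class of c; up to the transposition (x y) no colour class shrinks.
  shift-≼ : ∀ {f x y c} → f x ≡ nothing → f y ≡ just c → f ≼ shift f x y c
  shift-≼ {f} {x} {y} {c} fx≡nothing fy≡c =
    relabel-≼ (transpose x y) (transpose-injective x y) moved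
    where
    moved : ∀ z {α} → f z ≡ just α → shift f x y c (transpose x y z) ≡ just α
    moved z {α} fz≡α = by-cases (z ≟ x) (z ≟ y)
      where
      by-cases : Dec (z ≡ x) → Dec (z ≡ y) → shift f x y c (transpose x y z) ≡ just α
      by-cases (yes refl) _ with () ← trans (≡.sym fx≡nothing) fz≡α
      by-cases (no _) (yes refl) = begin
        shift f x y c (transpose x y y) ≡⟨ cong (shift f x y c) (transpose-maps-right x y) ⟩
        shift f x y c x                 ≡⟨ shift-x f x y c ⟩
        just c                          ≡⟨ trans (≡.sym fy≡c) fz≡α ⟩
        just α                          ∎
        where open ≡-Reasoning
      by-cases (no z≢x) (no z≢y) = begin
        shift f x y c (transpose x y z) ≡⟨ cong (shift f x y c) (transpose-fixes z≢x z≢y) ⟩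
        shift f x y c z                 ≡⟨ shift-elsewhere f c z≢x z≢y ⟩
        f z                             ≡⟨ fz≡α ⟩
        just α                          ∎
        where open ≡-Reasoning

  shift-keeps : ∀ f {x y z} c → z ≢ y → InDom f z → InDom (shift f x y c) z
  shift-keeps f {x} {y} {z} c z≢y (c' , fz≡c') with z ≟ x
  ... | yes refl = c , shift-x f x y c
  ... | no  z≢x  = c' , trans (shift-elsewhere f c z≢x z≢y) fz≡c'

  module _ (degree-lists : IsDegreeListAssignment G L) where

    neighboursBesides : Fin n → Fin n → List (Fin n)
    neighboursBesides x y = filter (λ z → adj? G x z ×-dec ¬? (z ≟ y)) (allFin n)

    neighboursBesides-spec : ∀ {x y z} → z ∈ neighboursBesides x y → Adj G x z × z ≢ y
    neighboursBesides-spec z∈others = proj₂ (∈-filter⁻ _ {xs = allFin n} z∈others)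

    neighboursBesides-< : ∀ {x y} → Adj G x y → length (neighboursBesides x y) < deg G x
    neighboursBesides-< {x} {y} x~y =
      unique-length-≤ _≟_ (y∉others ∷ Unique.filter⁺ _ (Unique.allFin⁺ n)) y∷others⊆neighbours
      where
      y∉others : All (y ≢_) (neighboursBesides x y)
      y∉others = All.tabulate (λ z∈others y≡z → proj₂ (neighboursBesides-spec z∈others) (≡.sym y≡z))
      y∷others⊆neighbours : y ∷ neighboursBesides x y ⊆ filter (adj? G x) (allFin n)
      y∷others⊆neighbours (here refl)     = ∈-filter⁺ (adj? G x) (∈-allFin y) x~y
      y∷others⊆neighbours (there z∈others) =
        ∈-filter⁺ (adj? G x) (∈-allFin _) (proj₁ (neighboursBesides-spec z∈others))

    coloursBesides : PartialColoring n → Fin n → Fin n → List ℕ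
    coloursBesides f x y = mapMaybe f (neighboursBesides x y)

    ∉coloursBesides⇒free : ∀ {f x y c} → c ∉ coloursBesides f x y → FreeBesides f x y c
    ∉coloursBesides⇒free {f} {x} {y} {c} c∉colours z x~z z≢y fz≡c =
      c∉colours (mapMaybe⁺ f _ (gmap c-at-z (∈-filter⁺ _ (∈-allFin z) (x~z , z≢y))))
      where
      c-at-z : ∀ {w} → z ≡ w → MaybeAny.Any (c ≡_) (f w)
      c-at-z refl = subst (MaybeAny.Any (c ≡_)) (≡.sym fz≡c) (MaybeAny.just refl)

    -- Pigeonhole: fewer than deg(x) ≤ |L(x)| colours appear on the neighbours
    -- of x other than y, so some colour of L(x) is free at x besides y.
    spare-colour : ∀ f {x y} → Adj G x y → ∃[ c ] c ∈ L x × FreeBesides f x y c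
    spare-colour f {x} {y} x~y with all? (_∈? coloursBesides f x y) (L x)
    ... | no some-missing with find (¬All⇒Any¬ (_∈? coloursBesides f x y) (L x) some-missing)
    ...   | c , c∈Lx , c∉colours = c , c∈Lx , ∉coloursBesides⇒free c∉colours
    spare-colour f {x} {y} x~y | yes all-used = ⊥-elim (n≮n (length (L x)) (begin-strict
      length (L x)                    ≤⟨ unique-length-≤ _≟ℕ_ (proj₁ (degree-lists x)) (All.lookup all-used) ⟩
      length (coloursBesides f x y)   ≤⟨ length-mapMaybe f (neighboursBesides x y) ⟩
      length (neighboursBesides x y)  <⟨ neighboursBesides-< x~y ⟩
      deg G x                         ≤⟨ proj₂ (degree-lists x) ⟩
      length (L x)                    ∎))
      where open ≤-Reasoning

    module _ (u : Fin n) where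

      record Improvement (f : PartialColoring n) (x : Fin n) : Set where
        constructor improvement
        field
          colouring : PartialColoring n
          proper    : IsProperLColouring colouring
          dominates : f ≼ colouring
          keeps     : Keeps u f colouring
          covers    : x ≢ u → InDom colouring x

      fill : ∀ {f x} → IsProperLColouring f → f x ≡ nothing → Walk G x u → Improvement f x
      fill {f} proper-f _ here = improvement f proper-f (≼-refl {f = f}) Keeps-refl (λ u≢u → ⊥-elim (u≢u refl))
      fill {f} {x} proper-f fx≡nothing (step {y = y} x~y walk)
        with spare-colour f x~y
      ... | c , c∈Lx , free-besides with ≡-dec _≟ℕ_ (f y) (just c)
      ...   | no fy≢c =
        improvement (f [ x ↦ just c ])
          (colour-proper proper-f c∈Lx (free-besides⇒free free-besides fy≢c))
          (⊑⇒≼ f⊑f') (⊑⇒Keeps f⊑f') (λ _ → c , ↦-here f x (just c))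
        where
        f⊑f' : f ⊑ (f [ x ↦ just c ])
        f⊑f' = colour-extends f c fx≡nothing
      ...   | yes fy≡c with fill (shift-proper proper-f c∈Lx free-besides) (shift-y f c x~y) walk
      ...     | improvement f' proper-f' dominates' keeps' covers' =
        improvement f' proper-f' (≼-trans {f = f} {shift f x y c} {f'} (shift-≼ fx≡nothing fy≡c) dominates') keeps
          (λ x≢u → keeps' x x≢u (c , shift-x f x y c))
        where
        keeps : Keeps u f f'
        keeps z z≢u z-coloured with z ≟ y
        ... | yes refl = covers' z≢u
        ... | no  z≢y  = keeps' z z≢u (shift-keeps f c z≢y z-coloured)

      colour-vertex : Connected G → ∀ {f} → IsProperLColouring f → ∀ x → Improvement f x
      colour-vertex connected {f} proper-f x with f x in fx
      ... | just c  = improvement f proper-f (≼-refl {f = f}) Keeps-refl (λ _ → c , fx)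
      ... | nothing = fill proper-f fx (connected x u)

      colour-all : Connected G → ∀ {f} → IsProperLColouring f → (xs : List (Fin n)) →
                   Σ (PartialColoring n) λ f' → IsProperLColouring f' × f ≼ f' ×
                     (∀ z → z ∈ xs → z ≢ u → InDom f' z)
      colour-all connected {f} proper-f [] = f , proper-f , ≼-refl {f = f} , λ _ ()
      colour-all connected {f} proper-f (x ∷ xs) with colour-all connected proper-f xs
      ... | f₁ , proper-f₁ , f≼f₁ , covers-xs with colour-vertex connected proper-f₁ x
      ...   | improvement f₂ proper-f₂ f₁≼f₂ keeps covers-x =
        f₂ , proper-f₂ , ≼-trans {f = f} {f₁} {f₂} f≼f₁ f₁≼f₂ , covers
        where
        covers : ∀ z → z ∈ x ∷ xs → z ≢ u → InDom f₂ z
        covers z (here refl)  z≢u = covers-x z≢u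
        covers z (there z∈xs) z≢u = keeps z z≢u (covers-xs z z∈xs z≢u)

lemma4p1 : (n : ℕ) (G : Graph n) → Connected G →
    (L : ListAssignment n) → IsDegreeListAssignment G L →
    (g : PartialColoring n) → IsPartialLColoring L g → IsProper G g →
    (u : Fin n) →
    Σ (PartialColoring n) (λ f →
      IsPartialLColoring L f × IsProper G f ×
      ((x : Fin n) → x ≢ u → InDom f x) × (f ≽[ L ] g))
lemma4p1 n G connected L degree-lists g g-L-colouring g-proper u
  with colour-all G L degree-lists u connected (g-L-colouring , g-proper) (allFin n)
... | f , (f-L-colouring , f-proper) , g≼f , covers =
  f , f-L-colouring , f-proper , (λ x x≢u → covers x (∈-allFin x) x≢u) , (λ α _ → g≼f α)
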